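{- Neither the TPTL-formula $x.\mathsf{F}\mathsf{F}\mathsf{F}(x\in[0,0])$ (which uses one register variable, only the operator $\mathsf{F}$, and only constraints of the form $x\in[0,0]$) nor the TPTL-formula $x.\mathsf{F}(b\wedge\mathsf{F}(c\wedge x\in(-\infty,2]))$ (with $b,c$ propositional variables) is equivalent to any MTL-formula.
   Context: Let $\mathcal{P}$ be a finite set of propositional variables. A data word is an infinite sequence $w=(P_0,d_0)(P_1,d_1)\dots$ with $P_i\subseteq\mathcal{P}$ and $d_i\in\mathbb{N}$. Intervals $I$ are (half-)open or (half-)closed intervals of integers with endpoints in $\mathbb{Z}\cup\{\pm\infty\}$. MTL formulas: $\varphi::=p\mid\neg\varphi\mid\varphi_1\wedge\varphi_2\mid\varphi_1\mathsf{U}_I\varphi_2$, with $(w,i)\models\varphi_1\mathsf{U}_I\varphi_2$ iff there is $j>i$ with $(w,j)\models\varphi_2$, $d_j-d_i\in I$, and $(w,k)\models\varphi_1$ for all $i<k<j$; $(w,i)\models p$ iff $p\in P_i$; $w\models\varphi$ iff $(w,0)\models\varphi$. TPTL formulas: $\varphi::=p\mid x\in I\mid\neg\varphi\mid\varphi_1\wedge\varphi_2\mid\varphi_1\mathsf{U}\varphi_2\mid x.\varphi$ with register variables $x$; with a valuation $\nu$ of registers in $\mathbb{N}$: $(w,i,\nu)\models x\in I$ iff $d_i-\nu(x)\in I$; $(w,i,\nu)\models x.\varphi$ iff $(w,i,\nu[x\mapsto d_i])\models\varphi$; $(w,i,\nu)\models\varphi_1\mathsf{U}\varphi_2$ iff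 there is $j>i$ with $(w,j,\nu)\models\varphi_2$ and $(w,k,\nu)\models\varphi_1$ for all $i<k<j$. $w\models\varphi$ iff $(w,0,\nu_0)\models\varphi$ with $\nu_0$ mapping every register to $d_0$. Abbreviation: $\mathsf{F}\varphi:=\mathrm{true}\,\mathsf{U}\,\varphi$ (strict future). A TPTL formula is equivalent to an MTL formula if both are satisfied by exactly the same data words. -}

module Defs where

open import Data.Nat using (ℕ; _<_)
open import Data.Integer as ℤ using (ℤ; +_; _-_)
open import Data.Bool using (Bool; true; false)
open import Data.Fin using (Fin)
open import Data.Fin.Subset using (Subset; _∈_)
open import Data.Product using (Σ; _×_; _,_; proj₁; proj₂)
open import Data.Unit using (⊤)
open import Relation.Nullary using (¬_)
open import Function.Bundles using (_⇔_)

data Bound : Set where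
  ∞b  : Bound                 -- -∞ (as lower bound) or +∞ (as upper bound)
  fin : ℤ → Bool → Bound      -- finite endpoint, Bool = closed?

record Interval : Set where
  constructor ⟨_,_⟩
  field
    lower : Bound
    upper : Bound

AboveLower : Bound → ℤ → Set
AboveLower ∞b          z = ⊤
AboveLower (fin a true)  z = a ℤ.≤ z
AboveLower (fin a false) z = a ℤ.< z

BelowUpper : Bound → ℤ → Set
BelowUpper ∞b          z = ⊤
BelowUpper (fin b true)  z = z ℤ.≤ b
BelowUpper (fin b false) z = z ℤ.< b

_∈I_ : ℤ → Interval → Set
z ∈I ⟨ l , u ⟩ = AboveLower l z × BelowUpper u z

DataWord : ℕ → Set
DataWord n = ℕ → Subset n × ℕ

props : ∀ {n} → DataWord n → ℕ → Subset n
props w i = proj₁ (w i)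

dat : ∀ {n} → DataWord n → ℕ → ℕ
dat w i = proj₂ (w i)

data MTL (n : ℕ) : Set where
  prop : Fin n → MTL n
  ¬ₘ_  : MTL n → MTL n
  _∧ₘ_ : MTL n → MTL n → MTL n
  _U[_]_ : MTL n → Interval → MTL n → MTL n

_,_⊨ₘ_ : ∀ {n} → DataWord n → ℕ → MTL n → Set
w , i ⊨ₘ prop p = p ∈ props w i
w , i ⊨ₘ (¬ₘ φ) = ¬ (w , i ⊨ₘ φ)
w , i ⊨ₘ (φ ∧ₘ ψ) = (w , i ⊨ₘ φ) × (w , i ⊨ₘ ψ)
w , i ⊨ₘ (φ U[ I ] ψ) =
  Σ ℕ λ j → (i < j) × ((+ dat w j - + dat w i) ∈I I) × (w , j ⊨ₘ ψ)
          × (∀ k → i < k → k < j → w , k ⊨ₘ φ)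

_⊨MTL_ : ∀ {n} → DataWord n → MTL n → Set
w ⊨MTL φ = w , 0 ⊨ₘ φ

Register : Set
Register = ℕ

Valuation : Set
Valuation = Register → ℕ

_[_↦_] : Valuation → Register → ℕ → Valuation
(ν [ x ↦ d ]) y with Data.Nat._≟_ x y
... | Relation.Nullary.yes _ = d
... | Relation.Nullary.no _  = ν y
  where import Data.Nat

data TPTL (n : ℕ) : Set where
  prop  : Fin n → TPTL n
  _∈ᵣ_  : Register → Interval → TPTL n
  ¬ₜ_   : TPTL n → TPTL n
  _∧ₜ_  : TPTL n → TPTL n → TPTL n
  _Uₜ_  : TPTL n → TPTL n → TPTL n
  _∙_   : Register → TPTL n → TPTL n

_,_,_⊨ₜ_ : ∀ {n} → DataWord n → ℕ → Valuation → TPTL n → Set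
w , i , ν ⊨ₜ prop p = p ∈ props w i
w , i , ν ⊨ₜ (x ∈ᵣ I) = (+ dat w i - + ν x) ∈I I
w , i , ν ⊨ₜ (¬ₜ φ) = ¬ (w , i , ν ⊨ₜ φ)
w , i , ν ⊨ₜ (φ ∧ₜ ψ) = (w , i , ν ⊨ₜ φ) × (w , i , ν ⊨ₜ ψ)
w , i , ν ⊨ₜ (φ Uₜ ψ) =
  Σ ℕ λ j → (i < j) × (w , j , ν ⊨ₜ ψ) × (∀ k → i < k → k < j → w , k , ν ⊨ₜ φ)
w , i , ν ⊨ₜ (x ∙ φ) = w , i , (ν [ x ↦ dat w i ]) ⊨ₜ φ

_⊨TPTL_ : ∀ {n} → DataWord n → TPTL n → Set
w ⊨TPTL φ = w , 0 , (λ _ → dat w 0) ⊨ₜ φ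

-- true := ¬(p ∧ ¬p) is unavailable when there are no propositions,
-- so we use the trivial constraint x ∈ (-∞,+∞) as "true".
trueₜ : ∀ {n} → TPTL n
trueₜ = 0 ∈ᵣ ⟨ ∞b , ∞b ⟩

Fₜ : ∀ {n} → TPTL n → TPTL n
Fₜ φ = trueₜ Uₜ φ

EquivalentToMTL : ∀ {n} → TPTL n → MTL n → Set
EquivalentToMTL φ ψ = ∀ w → (w ⊨TPTL φ) ⇔ (w ⊨MTL ψ)

x : Register
x = 0

[0,0] : Interval
[0,0] = ⟨ fin (+ 0) true , fin (+ 0) true ⟩

[-∞,2] : Interval
[-∞,2] = ⟨ ∞b , fin (+ 2) true ⟩

φ₁ : ∀ {n} → TPTL n
φ₁ = x ∙ Fₜ (Fₜ (Fₜ (x ∈ᵣ [0,0])))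

φ₂ : ∀ {n} → Fin n → Fin n → TPTL n
φ₂ b c = x ∙ Fₜ (prop b ∧ₜ Fₜ (prop c ∧ₜ (x ∈ᵣ [-∞,2])))

-- An MTL formula evaluated at position 0 sees the data only through the differences
-- d_j - d_0, tested against intervals whose constants are all below some K.
-- Take the words  a, L, 2L, 3L, ...  and  L + a, L, 2L, 3L, ...  with a ≥ K + L.
-- Every position j ≥ 1 starts a copy of the same progression, so it satisfies the same
-- MTL formulas in both words; the first step is a drop of at least K in both words,
-- which no interval with constants below K can detect; and the later differences
-- of the second word are those of the first, delayed by one position. Hence the two
-- words satisfy the same MTL formulas with constants below K. Each of the two TPTL
-- formulas, comparing d_0 with the data at least three (resp. two) positions later, separates them.
module Submission where

open import Defs
open import Data.Nat using (ℕ; zero; suc; _+_; _*_; _⊔_; _≤_; _<_; z≤n; s≤s; z<s; NonZero)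
open import Data.Nat.Properties
  using (+-assoc; +-comm; +-suc; +-identityʳ; *-identityˡ; ≤-refl; ≤-reflexive; ≤-trans; <-irrefl;
         1+n≰n; m≤m+n; m≤n+m; m<n+m; +-monoʳ-≤; +-monoˡ-<; +-cancelʳ-<; *-monoˡ-≤; *-cancelʳ-≡;
         m+n≤o⇒m≤o∸n; m≤n⇒∃[o]m+o≡n; m⊔n<o⇒m<o; m⊔n<o⇒n<o)
open import Data.Nat.Solver using (module +-*-Solver)
open import Data.Integer as ℤ using (ℤ; +_; -[1+_]; _-_; -_; _⊖_; +≤+; -<+; -<-)
import Data.Integer.Properties as ℤ
open import Data.Integer.Solver renaming (module +-*-Solver to ℤ-Solver)
open import Data.Fin using (Fin)
open import Data.Fin.Subset using (Subset; ⊤; _∈_)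
open import Data.Fin.Subset.Properties using (∈⊤)
open import Data.Product using (Σ; ∃-syntax; _×_; _,_)
open import Data.Unit using (tt)
open import Data.Bool using (true; false)
open import Data.Empty using (⊥-elim)
open import Function.Bundles using (Equivalence)
open import Relation.Nullary using (¬_)
open import Relation.Binary.PropositionalEquality
  using (_≡_; _≢_; refl; sym; trans; cong; cong₂; subst; module ≡-Reasoning)
open ≡-Reasoning

private
  variable
    n : ℕ

Δ : DataWord n → ℕ → ℕ → ℤ
Δ w i j = + dat w j - + dat w i

i-j≡[i-k]-[j-k] : ∀ i j k → i - j ≡ (i - k) - (j - k)
i-j≡[i-k]-[j-k] = ℤ-Solver.solve 3 (λ i j k → i :- j := (i :- k) :- (j :- k)) refl
  where open ℤ-Solver

+[k+m]-+[k+n] : ∀ k m n → + (k + m) - + (k + n) ≡ + m - + n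
+[k+m]-+[k+n] k m n = begin
  + (k + m) - + (k + n) ≡⟨ ℤ.m-n≡m⊖n (k + m) (k + n) ⟩
  (k + m) ⊖ (k + n)     ≡⟨ ℤ.+-cancelˡ-⊖ k m n ⟩
  m ⊖ n                 ≡⟨ ℤ.m-n≡m⊖n m n ⟨
  + m - + n             ∎

+k≤+m-+n : ∀ k m n → k + n ≤ m → + k ℤ.≤ + m - + n
+k≤+m-+n k m n k+n≤m
  rewrite ℤ.m-n≡m⊖n m n | ℤ.⊖-≥ (≤-trans (m≤n+m n k) k+n≤m) = +≤+ (m+n≤o⇒m≤o∸n k k+n≤m)

+m-+n≤-k : ∀ k m n → k + m ≤ n → + m - + n ℤ.≤ - + k
+m-+n≤-k k m n k+m≤n
  rewrite ℤ.m-n≡m⊖n m n | ℤ.⊖-≤ (≤-trans (m≤n+m m k) k+m≤n) =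
  ℤ.neg-mono-≤ (+≤+ (m+n≤o⇒m≤o∸n k k+m≤n))

m<n⇒∃[o]n≡1+o+m : ∀ {m n} → m < n → ∃[ o ] n ≡ suc o + m
m<n⇒∃[o]n≡1+o+m {m} m<n with m≤n⇒∃[o]m+o≡n m<n
... | o , refl = o , cong suc (+-comm m o)

record Congruent (w : DataWord n) (i : ℕ) (w' : DataWord n) (i' : ℕ) : Set where
  field
    props≡ : ∀ k → props w (k + i) ≡ props w' (k + i')
    Δ≡     : ∀ k → Δ w i (k + i) ≡ Δ w' i' (k + i')
open Congruent

congruent-sym : ∀ {w i w' i'} → Congruent {n} w i w' i' → Congruent w' i' w i
congruent-sym c = record { props≡ = λ k → sym (props≡ c k) ; Δ≡ = λ k → sym (Δ≡ c k) }

congruent-+ : ∀ {w i w' i'} → Congruent {n} w i w' i' → ∀ m → Congruent w (m + i) w' (m + i')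
congruent-+ {w = w} {i} {w'} {i'} c m = record { props≡ = props≡-+ ; Δ≡ = Δ≡-+ }
  where
  props≡-+ : ∀ k → props w (k + (m + i)) ≡ props w' (k + (m + i'))
  props≡-+ k rewrite sym (+-assoc k m i) | sym (+-assoc k m i') = props≡ c (k + m)
  Δ≡-+ : ∀ k → Δ w (m + i) (k + (m + i)) ≡ Δ w' (m + i') (k + (m + i'))
  Δ≡-+ k rewrite sym (+-assoc k m i) | sym (+-assoc k m i') = begin
    Δ w (m + i) (k + m + i)
      ≡⟨ i-j≡[i-k]-[j-k] (+ dat w (k + m + i)) (+ dat w (m + i)) (+ dat w i) ⟩
    Δ w i (k + m + i) - Δ w i (m + i)
      ≡⟨ cong₂ _-_ (Δ≡ c (k + m)) (Δ≡ c m) ⟩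
    Δ w' i' (k + m + i') - Δ w' i' (m + i')
      ≡⟨ i-j≡[i-k]-[j-k] (+ dat w' (k + m + i')) (+ dat w' (m + i')) (+ dat w' i') ⟨
    Δ w' (m + i') (k + m + i')
      ∎

⊨ₘ-congruent : ∀ {w i w' i'} (ψ : MTL n) → Congruent w i w' i' → w , i ⊨ₘ ψ → w' , i' ⊨ₘ ψ
⊨ₘ-congruent (prop p) c ⊨p = subst (p ∈_) (props≡ c 0) ⊨p
⊨ₘ-congruent (¬ₘ ψ) c ⊭ψ ⊨ψ = ⊭ψ (⊨ₘ-congruent ψ (congruent-sym c) ⊨ψ)
⊨ₘ-congruent (ψ ∧ₘ χ) c (⊨ψ , ⊨χ) = ⊨ₘ-congruent ψ c ⊨ψ , ⊨ₘ-congruent χ c ⊨χ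
⊨ₘ-congruent {w = w} {i} {w'} {i'} (α U[ I ] β) c (j , i<j , Δ∈I , ⊨β , ⊨α)
  with m<n⇒∃[o]n≡1+o+m i<j
... | t , refl =
  suc t + i' , m<n+m i' z<s , subst (_∈I I) (Δ≡ c (suc t)) Δ∈I ,
  ⊨ₘ-congruent β (congruent-+ c (suc t)) ⊨β , between
  where
  between : ∀ k' → i' < k' → k' < suc t + i' → w' , k' ⊨ₘ α
  between k' i'<k' k'<j' with m<n⇒∃[o]n≡1+o+m i'<k'
  ... | s , refl = ⊨ₘ-congruent α (congruent-+ c (suc s))
    (⊨α (suc s + i) (m<n+m i z<s) (+-monoˡ-< i (+-cancelʳ-< i' (suc s) (suc t) k'<j')))

boundB : Bound → ℕ
boundB ∞b        = 0
boundB (fin c _) = ℤ.∣ c ∣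

boundI : Interval → ℕ
boundI ⟨ l , u ⟩ = boundB l ⊔ boundB u

bound : MTL n → ℕ
bound (prop _)       = 0
bound (¬ₘ ψ)         = bound ψ
bound (ψ ∧ₘ χ)       = bound ψ ⊔ bound χ
bound (α U[ I ] β)   = bound α ⊔ (boundI I ⊔ bound β)

∣c∣<K⇒-K<c : ∀ {K} c → ℤ.∣ c ∣ < K → - + K ℤ.< c
∣c∣<K⇒-K<c {suc K} (+ m)    _          = -<+
∣c∣<K⇒-K<c {suc K} -[1+ m ] (s≤s m<K) = -<- m<K

deep⇒BelowUpper : ∀ {K} u {z} → boundB u < K → z ℤ.≤ - + K → BelowUpper u z
deep⇒BelowUpper ∞b           _  _    = tt
deep⇒BelowUpper (fin c true)  bu z≤-K = ℤ.≤-trans z≤-K (ℤ.<⇒≤ (∣c∣<K⇒-K<c c bu))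
deep⇒BelowUpper (fin c false) bu z≤-K = ℤ.≤-<-trans z≤-K (∣c∣<K⇒-K<c c bu)

deep-AboveLower : ∀ {K} l {z z'} → boundB l < K → z ℤ.≤ - + K → AboveLower l z → AboveLower l z'
deep-AboveLower ∞b            _  _    _   = tt
deep-AboveLower (fin c true)  bl z≤-K c≤z =
  ⊥-elim (ℤ.<⇒≱ (∣c∣<K⇒-K<c c bl) (ℤ.≤-trans c≤z z≤-K))
deep-AboveLower (fin c false) bl z≤-K c<z =
  ⊥-elim (ℤ.<⇒≱ (∣c∣<K⇒-K<c c bl) (ℤ.<⇒≤ (ℤ.<-≤-trans c<z z≤-K)))

data Close (K : ℕ) (z z' : ℤ) : Set where
  equal : z ≡ z' → Close K z z'
  deep  : z ℤ.≤ - + K → z' ℤ.≤ - + K → Close K z z'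

∈I-close : ∀ {K} I {z z'} → boundI I < K → Close K z z' → z ∈I I → z' ∈I I
∈I-close I _ (equal refl) z∈I = z∈I
∈I-close ⟨ l , u ⟩ bI (deep z≤-K z'≤-K) (above , _) =
  deep-AboveLower l (m⊔n<o⇒m<o (boundB l) (boundB u) bI) z≤-K above ,
  deep⇒BelowUpper u (m⊔n<o⇒n<o (boundB l) (boundB u) bI) z'≤-K

-- A jump to position 1+m of one word is answered by a jump to 1+m' of the other; the
-- answer may pass over positions only if the jump passes over position 1, which then
-- satisfies the left argument of the until, and by congruence so do all later positions.
record Similar (K : ℕ) (w w' : DataWord n) : Set where
  field
    props₀ : props w 0 ≡ props w' 0
    tail   : ∀ m m' → Congruent w (suc m) w' (suc m')
    step   : ∀ m → Σ ℕ λ m' → Close K (Δ w 0 (suc m)) (Δ w' 0 (suc m')) × (0 < m' → 0 < m)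
    step⁻¹ : ∀ m' → Σ ℕ λ m → Close K (Δ w' 0 (suc m')) (Δ w 0 (suc m)) × (0 < m → 0 < m')

similar-sym : ∀ {K} {w w'} → Similar {n} K w w' → Similar K w' w
similar-sym S = record
  { props₀ = sym props₀
  ; tail   = λ m' m → congruent-sym (tail m m')
  ; step   = step⁻¹
  ; step⁻¹ = step
  }
  where open Similar S

⊨ₘ-similar : ∀ {K} {w w'} → Similar K w w' → (ψ : MTL n) → bound ψ < K → w ⊨MTL ψ → w' ⊨MTL ψ
⊨ₘ-similar S (prop p) _ ⊨p = subst (p ∈_) (Similar.props₀ S) ⊨p
⊨ₘ-similar S (¬ₘ ψ) bψ ⊭ψ ⊨ψ = ⊭ψ (⊨ₘ-similar (similar-sym S) ψ bψ ⊨ψ)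
⊨ₘ-similar S (ψ ∧ₘ χ) b (⊨ψ , ⊨χ) =
  ⊨ₘ-similar S ψ (m⊔n<o⇒m<o (bound ψ) (bound χ) b) ⊨ψ ,
  ⊨ₘ-similar S χ (m⊔n<o⇒n<o (bound ψ) (bound χ) b) ⊨χ
⊨ₘ-similar {w' = w'} S (α U[ I ] β) b (suc m , _ , Δ∈I , ⊨β , ⊨α) with Similar.step S m
... | m' , close , m'>0⇒m>0 =
  suc m' , z<s , ∈I-close I (m⊔n<o⇒m<o (boundI I) (bound β) (m⊔n<o⇒n<o (bound α) _ b)) close Δ∈I ,
  ⊨ₘ-congruent β (Similar.tail S m m') ⊨β , between
  where
  between : ∀ k → 0 < k → k < suc m' → w' , k ⊨ₘ α
  between (suc s) _ (s≤s s<m') =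
    ⊨ₘ-congruent α (Similar.tail S 0 s) (⊨α 1 z<s (s≤s (m'>0⇒m>0 (≤-trans z<s s<m'))))

separated⇒¬EquivalentToMTL : ∀ {K w w'} (χ : TPTL n) (ψ : MTL n) → bound ψ < K → Similar K w w' →
                             w ⊨TPTL χ → ¬ w' ⊨TPTL χ → ¬ EquivalentToMTL χ ψ
separated⇒¬EquivalentToMTL {w = w} {w'} χ ψ bψ S ⊨χ ⊭χ χ⇔ψ =
  ⊭χ (Equivalence.from (χ⇔ψ w') (⊨ₘ-similar S ψ bψ (Equivalence.to (χ⇔ψ w) ⊨χ)))

jump : Subset n → ℕ → ℕ → DataWord n
jump P L a i = P , datum i
  where
  datum : ℕ → ℕ
  datum zero    = a
  datum (suc m) = suc m * L

Δ-jump-tail : ∀ (P : Subset n) L a k m → Δ (jump P L a) (suc m) (k + suc m) ≡ + (k * L)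
Δ-jump-tail P L a k m rewrite +-suc k m = begin
  + (suc (k + m) * L) - + (suc m * L)
    ≡⟨ cong₂ (λ d e → + d - + e) distrib (sym (+-identityʳ (suc m * L))) ⟩
  + (suc m * L + k * L) - + (suc m * L + 0)
    ≡⟨ +[k+m]-+[k+n] (suc m * L) (k * L) 0 ⟩
  + (k * L) - + 0
    ≡⟨ ℤ.+-identityʳ (+ (k * L)) ⟩
  + (k * L)
    ∎
  where
  open +-*-Solver
  distrib : suc (k + m) * L ≡ suc m * L + k * L
  distrib = solve 3 (λ k m L → (con 1 :+ (k :+ m)) :* L := (con 1 :+ m) :* L :+ k :* L) refl k m L

jump-congruent : ∀ (P : Subset n) L a a' m m' → Congruent (jump P L a) (suc m) (jump P L a') (suc m')
jump-congruent P L a a' m m' = record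
  { props≡ = λ _ → refl
  ; Δ≡     = λ k → trans (Δ-jump-tail P L a k m) (sym (Δ-jump-tail P L a' k m'))
  }

jump-similar : ∀ {K} (P : Subset n) L a → K + L ≤ a → Similar K (jump P L (L + a)) (jump P L a)
jump-similar {K = K} P L a K+L≤a = record
  { props₀ = refl
  ; tail   = jump-congruent P L (L + a) a
  ; step   = λ { zero    → 0 , deep first-drop first-drop′ , λ ()
               ; (suc m) → m , equal (+[k+m]-+[k+n] L (suc m * L) a) , λ _ → z<s }
  ; step⁻¹ = λ { zero    → 0 , deep first-drop′ first-drop , λ ()
               ; (suc m) → suc (suc m) , equal (sym (+[k+m]-+[k+n] L (suc (suc m) * L) a)) , λ _ → z<s }
  }
  where
  K+1*L≤a : K + 1 * L ≤ a
  K+1*L≤a = subst (λ l → K + l ≤ a) (sym (*-identityˡ L)) K+L≤a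
  first-drop′ : Δ (jump P L a) 0 1 ℤ.≤ - + K
  first-drop′ = +m-+n≤-k K (1 * L) a K+1*L≤a
  first-drop : Δ (jump P L (L + a)) 0 1 ℤ.≤ - + K
  first-drop = +m-+n≤-k K (1 * L) (L + a) (≤-trans K+1*L≤a (m≤n+m a L))

+m-+n∈[0,0]⇒m≡n : ∀ m n → (+ m - + n) ∈I [0,0] → m ≡ n
+m-+n∈[0,0]⇒m≡n m n (0≤d , d≤0) = ℤ.+-injective (ℤ.i-j≡0⇒i≡j (+ m) (+ n) (ℤ.≤-antisym d≤0 0≤d))

φ₁-holds : ∀ (P : Subset n) L → jump P L (L + 2 * L) ⊨TPTL φ₁
φ₁-holds P L =
  1 , z<s , (2 , ≤-refl , (3 , ≤-refl , Δ₃∈[0,0] , λ _ _ _ → tt , tt) , λ _ _ _ → tt , tt) , λ _ _ _ → tt , tt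
  where
  Δ₃∈[0,0] : (+ (3 * L) - + (3 * L)) ∈I [0,0]
  Δ₃∈[0,0] = subst (_∈I [0,0]) (sym (ℤ.+-inverseʳ (+ (3 * L)))) (+≤+ z≤n , +≤+ z≤n)

φ₁-fails : ∀ (P : Subset n) L .{{_ : NonZero L}} → ¬ jump P L (2 * L) ⊨TPTL φ₁
φ₁-fails P L (j₁ , 0<j₁ , (j₂ , j₁<j₂ , (j₃ , j₂<j₃ , Δ∈[0,0] , _) , _) , _) =
  no-return j₃ (≤-trans (s≤s (≤-trans (s≤s 0<j₁) j₁<j₂)) j₂<j₃) Δ∈[0,0]
  where
  no-return : ∀ j → 2 < j → ¬ (+ dat (jump P L (2 * L)) j - + (2 * L)) ∈I [0,0]
  no-return (suc m) 2<j Δ∈ = <-irrefl (sym (*-cancelʳ-≡ (suc m) 2 L (+m-+n∈[0,0]⇒m≡n _ _ Δ∈))) 2<j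

φ₂-holds : ∀ {P : Subset n} {b c} → b ∈ P → c ∈ P → ∀ L a → L ≤ a → jump P L (L + a) ⊨TPTL φ₂ b c
φ₂-holds b∈P c∈P L a L≤a =
  1 , z<s , (b∈P , (2 , ≤-refl , (c∈P , (tt , Δ₂≤2)) , λ _ _ _ → tt , tt)) , λ _ _ _ → tt , tt
  where
  Δ₂≤2 : + (2 * L) - + (L + a) ℤ.≤ + 2
  Δ₂≤2 = ℤ.≤-trans (+m-+n≤-k 0 (2 * L) (L + a) (+-monoʳ-≤ L (subst (_≤ a) (sym (+-identityʳ L)) L≤a)))
                   (+≤+ z≤n)

φ₂-fails : ∀ (P : Subset n) b c L a → 3 + a ≤ 2 * L → ¬ jump P L a ⊨TPTL φ₂ b c
φ₂-fails P b c L a 3+a≤2L (j₁ , 0<j₁ , (_ , (j₂ , j₁<j₂ , (_ , (_ , Δ≤2)) , _)) , _) =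
  too-far j₂ (≤-trans (s≤s 0<j₁) j₁<j₂) Δ≤2
  where
  too-far : ∀ j → 1 < j → ¬ (+ dat (jump P L a) j - + a ℤ.≤ + 2)
  too-far 1             (s≤s ()) _
  too-far (suc (suc m)) _ Δ≤2 = 1+n≰n (ℤ.drop‿+≤+ (ℤ.≤-trans 3≤Δ Δ≤2))
    where
    3≤Δ : + 3 ℤ.≤ + (suc (suc m) * L) - + a
    3≤Δ = +k≤+m-+n 3 (suc (suc m) * L) a
            (≤-trans 3+a≤2L (*-monoˡ-≤ L {2} {suc (suc m)} (s≤s (s≤s z≤n))))

φ₁-not-MTL : ∀ n (ψ : MTL n) → ¬ EquivalentToMTL φ₁ ψ
φ₁-not-MTL n ψ = separated⇒¬EquivalentToMTL φ₁ ψ ≤-refl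
  (jump-similar ⊤ K (2 * K) (+-monoʳ-≤ K (m≤m+n K 0))) (φ₁-holds {n} ⊤ K) (φ₁-fails {n} ⊤ K)
  where
  K : ℕ
  K = suc (bound ψ)

φ₂-not-MTL : ∀ {n} (b c : Fin n) (ψ : MTL n) → ¬ EquivalentToMTL (φ₂ b c) ψ
φ₂-not-MTL b c ψ = separated⇒¬EquivalentToMTL (φ₂ b c) ψ ≤-refl
  (jump-similar ⊤ L (K + L) ≤-refl)
  (φ₂-holds ∈⊤ ∈⊤ L (K + L) (m≤n+m L K))
  (φ₂-fails ⊤ b c L (K + L) 3+a≤2L)
  where
  open +-*-Solver
  K L : ℕ
  K = suc (bound ψ)
  L = K + 3
  3+a≤2L : 3 + (K + L) ≤ 2 * L
  3+a≤2L = ≤-reflexive (solve 1 (λ K → con 3 :+ (K :+ (K :+ con 3)) := con 2 :* (K :+ con 3)) refl K)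

-- The separating words make every proposition true everywhere.
proposition1 : ((n : ℕ) → (ψ : MTL n) → ¬ EquivalentToMTL φ₁ ψ)
    × ((n : ℕ) → (b c : Fin n) → b ≢ c → (ψ : MTL n) → ¬ EquivalentToMTL (φ₂ b c) ψ)
proposition1 = φ₁-not-MTL , λ _ b c _ → φ₂-not-MTL b c
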